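{- Let $n=p^k q^m$, where $p$ and $q$ are distinct primes, $k\geq 1$ and $m\geq 0$, and suppose $p\geq 2^{q^m}$. Then there do not exist integers $2<a_1<\dots<a_k<n$ and $1<b_1<\dots<b_m<n$ (for any number of terms on either side) with $a_i\neq b_j$ for all $i,j$, such that \[\binom{n}{0}+\binom{n}{a_1}+\dots+\binom{n}{a_k}=\binom{n}{1}+\binom{n}{b_1}+\dots+\binom{n}{b_m}.\]
   Context: The number of terms on each side of the identity is arbitrary (the letters $k,m$ used for the number of terms are independent of the exponents $k,m$ in $n=p^kq^m$). -}

module Defs where

open import Data.Nat using (ℕ)
open import Data.List using (List; map)
open import Data.Nat.ListAction using (sum)
open import Data.Nat.Combinatorics using (_C_)

binomSum : ℕ → List ℕ → ℕ
binomSum n xs = sum (map (n C_) xs)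

-- Write n = p ^ k * Q with Q = q ^ m.  A prime-power case of Lucas' theorem says that
-- n C a ≡ Q C t (mod p) when a = t * p ^ k, and n C a ≡ 0 (mod p) otherwise.  Reducing the
-- identity modulo p, where n C 0 = 1 and n C 1 = n ≡ 0, leaves 1 + Σ Q C tᵢ ≡ Σ Q C sⱼ over
-- the terms that are multiples of p ^ k.  The indices are distinct and lie strictly between
-- 0 and Q, so each side is at most 2 ^ Q − 1 < p and the congruence is an equality.  But q
-- divides Q C t for 0 < t < Q, hence q ∣ 1.
module Submission where

open import Defs
open import Data.Nat using (ℕ; _+_; _*_; _^_; _≤_; _<_)
open import Data.Nat.Primality using (Prime)
open import Data.Nat.Combinatorics using (_C_)
open import Data.List using (List)
open import Data.List.Relation.Unary.All using (All)
open import Data.List.Relation.Unary.Linked using (Linked)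
open import Data.List.Membership.Propositional using (_∈_)
open import Data.Product using (_×_; ∃₂)
open import Relation.Binary.PropositionalEquality using (_≡_; _≢_)
open import Relation.Nullary using (¬_)

open import Data.Nat using (zero; suc; pred; NonZero; >-nonZero⁻¹; z≤n; s≤s)
open import Data.Nat.Properties
open import Data.Nat.Combinatorics using (nCk+nC[k+1]≡[n+1]C[k+1]; k>n⇒nCk≡0; nCn≡1; nC1≡n)
open import Data.Nat.Divisibility
open import Data.Nat.DivMod using (_%_; %-distribˡ-+; %-remove-+ˡ; m<n⇒m%n≡m)
open import Data.Nat.Primality using (prime⇒nonZero; euclidsLemma; ¬prime[1])
open import Data.Nat.Tactic.RingSolver using (solve-∀)
open import Data.Nat.ListAction using (sum)
open import Data.List using ([]; _∷_; map)
open import Data.List.Relation.Unary.All using ([]; _∷_)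
import Data.List.Relation.Unary.All as All
open import Data.List.Relation.Unary.Linked using ([-]; _∷_)
open import Data.Product using (_,_)
open import Data.Sum using (inj₁; inj₂)
open import Data.Empty using (⊥-elim)
open import Level using (0ℓ)
open import Relation.Nullary using (yes; no)
open import Relation.Binary.Bundles using (Setoid)
import Relation.Binary.Reasoning.Setoid as SetoidReasoning
open import Relation.Binary.PropositionalEquality
  using (refl; sym; trans; cong; cong₂; subst; module ≡-Reasoning)

[n+1]C[k+1]≡nCk+nC[k+1] : ∀ n k → suc n C suc k ≡ n C k + n C suc k
[n+1]C[k+1]≡nCk+nC[k+1] n k = sym (nCk+nC[k+1]≡[n+1]C[k+1] n k)

[n+1]Cp≡nC[p-1]+nCp : ∀ n p .{{_ : NonZero p}} → suc n C p ≡ n C pred p + n C p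
[n+1]Cp≡nC[p-1]+nCp n (suc p) = [n+1]C[k+1]≡nCk+nC[k+1] n p

[k+1]*[n+1]C[k+1]≡[n+1]*nCk : ∀ n k → suc k * (suc n C suc k) ≡ suc n * (n C k)
[k+1]*[n+1]C[k+1]≡[n+1]*nCk zero    zero    = refl
[k+1]*[n+1]C[k+1]≡[n+1]*nCk zero    (suc k) rewrite *-zeroʳ k = refl
[k+1]*[n+1]C[k+1]≡[n+1]*nCk (suc n) zero
  rewrite nC1≡n (suc (suc n)) | *-identityʳ n | +-identityʳ n = refl
[k+1]*[n+1]C[k+1]≡[n+1]*nCk (suc n) (suc k) = begin
  suc (suc k) * (suc (suc n) C suc (suc k))
    ≡⟨ cong (suc (suc k) *_) ([n+1]C[k+1]≡nCk+nC[k+1] (suc n) (suc k)) ⟩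
  suc (suc k) * (suc n C suc k + suc n C suc (suc k))
    ≡⟨ expand (suc n C suc k) (suc n C suc (suc k)) (suc k) ⟩
  suc n C suc k + suc k * (suc n C suc k) + suc (suc k) * (suc n C suc (suc k))
    ≡⟨ cong₂ (λ u v → suc n C suc k + u + v) ([k+1]*[n+1]C[k+1]≡[n+1]*nCk n k)
                                             ([k+1]*[n+1]C[k+1]≡[n+1]*nCk n (suc k)) ⟩
  suc n C suc k + suc n * (n C k) + suc n * (n C suc k)
    ≡⟨ collect (suc n C suc k) (n C k) (n C suc k) (suc n) ⟩
  suc n C suc k + suc n * (n C k + n C suc k)
    ≡⟨ cong (λ u → suc n C suc k + suc n * u) ([n+1]C[k+1]≡nCk+nC[k+1] n k) ⟨
  suc (suc n) * (suc n C suc k)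
    ∎
  where
  open ≡-Reasoning
  expand : ∀ a b k → suc k * (a + b) ≡ a + k * a + suc k * b
  expand = solve-∀
  collect : ∀ c x y m → c + m * x + m * y ≡ c + m * (x + y)
  collect = solve-∀

p∣n⇒¬p∣k⇒p∣nCk : ∀ {p} → Prime p → ∀ n k → p ∣ n → ¬ p ∣ k → p ∣ n C k
p∣n⇒¬p∣k⇒p∣nCk _       n       zero    _   p∤0 = ⊥-elim (p∤0 (_ ∣0))
p∣n⇒¬p∣k⇒p∣nCk _       zero    (suc k) _   _   = _ ∣0
p∣n⇒¬p∣k⇒p∣nCk {p} p-prime (suc n) (suc k) p∣n p∤k
  with euclidsLemma (suc k) (suc n C suc k) p-prime
         (subst (p ∣_) (sym ([k+1]*[n+1]C[k+1]≡[n+1]*nCk n k)) (∣m⇒∣m*n (n C k) p∣n))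
... | inj₁ p∣k = ⊥-elim (p∤k p∣k)
... | inj₂ p∣C = p∣C

m^[1+n]*o≡m^n*o*m : ∀ m n o → m ^ suc n * o ≡ m ^ n * o * m
m^[1+n]*o≡m^n*o*m m n o = trans (*-assoc m (m ^ n) o) (*-comm m (m ^ n * o))

infix 4 _≡_mod_
record _≡_mod_ (a b d : ℕ) .{{_ : NonZero d}} : Set where
  constructor mk≡mod
  field %-≡ : a % d ≡ b % d

module _ {d : ℕ} .{{_ : NonZero d}} where

  ≡-mod-setoid : Setoid 0ℓ 0ℓ
  ≡-mod-setoid = record
    { Carrier       = ℕ
    ; _≈_           = λ a b → a ≡ b mod d
    ; isEquivalence = record
      { refl  = mk≡mod refl
      ; sym   = λ (mk≡mod a≡b) → mk≡mod (sym a≡b)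
      ; trans = λ (mk≡mod a≡b) (mk≡mod b≡c) → mk≡mod (trans a≡b b≡c)
      }
    }

  +-cong-mod : ∀ {a b c e} → a ≡ b mod d → c ≡ e mod d → a + c ≡ b + e mod d
  +-cong-mod {a} {b} {c} {e} (mk≡mod a≡b) (mk≡mod c≡e) = mk≡mod (begin
    (a + c) % d              ≡⟨ %-distribˡ-+ a c d ⟩
    (a % d + c % d) % d      ≡⟨ cong₂ (λ x y → (x + y) % d) a≡b c≡e ⟩
    (b % d + e % d) % d      ≡⟨ %-distribˡ-+ b e d ⟨
    (b + e) % d              ∎)
    where open ≡-Reasoning

  ∣⇒≡0-mod : ∀ {a} → d ∣ a → a ≡ 0 mod d
  ∣⇒≡0-mod {a} d∣a = mk≡mod (trans (n∣m⇒m%n≡0 a d d∣a) (sym (n∣m⇒m%n≡0 0 d (d ∣0))))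

  ≡0-mod⇒∣ : ∀ {a} → a ≡ 0 mod d → d ∣ a
  ≡0-mod⇒∣ {a} (mk≡mod a≡0) = m%n≡0⇒n∣m a d (trans a≡0 (n∣m⇒m%n≡0 0 d (d ∣0)))

  ≡-mod⇒≡ : ∀ {a b} → a < d → b < d → a ≡ b mod d → a ≡ b
  ≡-mod⇒≡ a<d b<d (mk≡mod a≡b) = trans (sym (m<n⇒m%n≡m a<d)) (trans a≡b (m<n⇒m%n≡m b<d))

  sum-map-cong-mod : ∀ {f g : ℕ → ℕ} → (∀ x → f x ≡ g x mod d) →
    ∀ xs → sum (map f xs) ≡ sum (map g xs) mod d
  sum-map-cong-mod f≡g []       = mk≡mod refl
  sum-map-cong-mod f≡g (x ∷ xs) = +-cong-mod (f≡g x) (sum-map-cong-mod f≡g xs)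

∣-sum-map : ∀ {d} {f : ℕ → ℕ} {xs} → All (λ x → d ∣ f x) xs → d ∣ sum (map f xs)
∣-sum-map []             = _ ∣0
∣-sum-map (d∣fx ∷ d∣fxs) = ∣m∣n⇒∣m+n d∣fx (∣-sum-map d∣fxs)

-- By Lucas' theorem, lucas (p ^ k) Q a is the residue of (p ^ k * Q) C a modulo p.
lucas : ℕ → ℕ → ℕ → ℕ
lucas B Q a with B ∣? a
... | yes (divides t _) = Q C t
... | no _              = 0

lucas-multiple : ∀ B Q t .{{_ : NonZero B}} → lucas B Q (t * B) ≡ Q C t
lucas-multiple B Q t with B ∣? t * B
... | yes (divides t′ t*B≡t′*B) = cong (Q C_) (sym (*-cancelʳ-≡ t t′ B t*B≡t′*B))
... | no B∤t*B                  = ⊥-elim (B∤t*B (n∣m*n t))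

lucas-nonmultiple : ∀ B Q a → ¬ B ∣ a → lucas B Q a ≡ 0
lucas-nonmultiple B Q a B∤a with B ∣? a
... | yes B∣a = ⊥-elim (B∤a B∣a)
... | no _    = refl

module _ {p : ℕ} (p-prime : Prime p) where

  private instance
    p≢0 : NonZero p
    p≢0 = prime⇒nonZero p-prime

  open SetoidReasoning (≡-mod-setoid {p})

  -- The next two lemmas compare coefficients in (1 + x) ^ (n + p) ≡ (1 + x) ^ n * (1 + x ^ p) (mod p).
  [n+p]Cj≡nCj-mod : ∀ n j → j < p → (n + p) C j ≡ n C j mod p
  [n+p]Cj≡nCj-mod zero    zero    _   = mk≡mod refl
  [n+p]Cj≡nCj-mod zero    (suc j) j<p =
    ∣⇒≡0-mod (p∣n⇒¬p∣k⇒p∣nCk p-prime p (suc j) ∣-refl (λ p∣j → <⇒≱ j<p (∣⇒≤ p∣j)))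
  [n+p]Cj≡nCj-mod (suc n) zero    _   = mk≡mod refl
  [n+p]Cj≡nCj-mod (suc n) (suc j) j<p = begin
    suc (n + p) C suc j              ≡⟨ [n+1]C[k+1]≡nCk+nC[k+1] (n + p) j ⟩
    (n + p) C j + (n + p) C suc j    ≈⟨ +-cong-mod ([n+p]Cj≡nCj-mod n j (<-trans (n<1+n j) j<p))
                                                   ([n+p]Cj≡nCj-mod n (suc j) j<p) ⟩
    n C j + n C suc j                ≡⟨ [n+1]C[k+1]≡nCk+nC[k+1] n j ⟨
    suc n C suc j                    ∎

  [n+p]C[j+p]≡nC[j+p]+nCj-mod : ∀ n j → (n + p) C (j + p) ≡ n C (j + p) + n C j mod p
  [n+p]C[j+p]≡nC[j+p]+nCj-mod zero zero
    rewrite nCn≡1 p | k>n⇒nCk≡0 {0} {p} (>-nonZero⁻¹ p) = mk≡mod refl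
  [n+p]C[j+p]≡nC[j+p]+nCj-mod zero (suc j)
    rewrite k>n⇒nCk≡0 {p} {suc j + p} (s≤s (m≤n+m p j)) = mk≡mod refl
  [n+p]C[j+p]≡nC[j+p]+nCj-mod (suc n) zero = begin
    suc (n + p) C p                   ≡⟨ [n+1]Cp≡nC[p-1]+nCp (n + p) p ⟩
    (n + p) C pred p + (n + p) C p    ≈⟨ +-cong-mod ([n+p]Cj≡nCj-mod n (pred p) (m≤pred[n]⇒suc[m]≤n ≤-refl))
                                                    ([n+p]C[j+p]≡nC[j+p]+nCj-mod n 0) ⟩
    n C pred p + (n C p + 1)          ≡⟨ +-assoc (n C pred p) (n C p) 1 ⟨
    n C pred p + n C p + 1            ≡⟨ cong (_+ 1) ([n+1]Cp≡nC[p-1]+nCp n p) ⟨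
    suc n C p + 1                     ∎
  [n+p]C[j+p]≡nC[j+p]+nCj-mod (suc n) (suc j) = begin
    suc (n + p) C suc (j + p)
      ≡⟨ [n+1]C[k+1]≡nCk+nC[k+1] (n + p) (j + p) ⟩
    (n + p) C (j + p) + (n + p) C suc (j + p)
      ≈⟨ +-cong-mod ([n+p]C[j+p]≡nC[j+p]+nCj-mod n j) ([n+p]C[j+p]≡nC[j+p]+nCj-mod n (suc j)) ⟩
    n C (j + p) + n C j + (n C suc (j + p) + n C suc j)
      ≡⟨ interchange (n C (j + p)) (n C j) (n C suc (j + p)) (n C suc j) ⟩
    n C (j + p) + n C suc (j + p) + (n C j + n C suc j)
      ≡⟨ cong₂ _+_ ([n+1]C[k+1]≡nCk+nC[k+1] n (j + p)) ([n+1]C[k+1]≡nCk+nC[k+1] n j) ⟨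
    suc n C suc (j + p) + suc n C suc j
      ∎
    where
    interchange : ∀ a b c e → a + b + (c + e) ≡ a + c + (b + e)
    interchange = solve-∀

  [N*p]C[t*p]≡NCt-mod : ∀ N t → (N * p) C (t * p) ≡ N C t mod p
  [N*p]C[t*p]≡NCt-mod zero    zero    = mk≡mod refl
  [N*p]C[t*p]≡NCt-mod zero    (suc t) = begin
    0 C (p + t * p)   ≡⟨ k>n⇒nCk≡0 {0} {p + t * p} (≤-trans (>-nonZero⁻¹ p) (m≤m+n p (t * p))) ⟩
    0                 ∎
  [N*p]C[t*p]≡NCt-mod (suc N) zero    = mk≡mod refl
  [N*p]C[t*p]≡NCt-mod (suc N) (suc t) = begin
    (p + N * p) C (p + t * p)
      ≡⟨ cong₂ _C_ (+-comm p (N * p)) (+-comm p (t * p)) ⟩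
    (N * p + p) C (t * p + p)
      ≈⟨ [n+p]C[j+p]≡nC[j+p]+nCj-mod (N * p) (t * p) ⟩
    (N * p) C (t * p + p) + (N * p) C (t * p)
      ≡⟨ cong (λ x → (N * p) C x + (N * p) C (t * p)) (+-comm (t * p) p) ⟩
    (N * p) C (suc t * p) + (N * p) C (t * p)
      ≈⟨ +-cong-mod ([N*p]C[t*p]≡NCt-mod N (suc t)) ([N*p]C[t*p]≡NCt-mod N t) ⟩
    N C suc t + N C t
      ≡⟨ +-comm (N C suc t) (N C t) ⟩
    N C t + N C suc t
      ≡⟨ [n+1]C[k+1]≡nCk+nC[k+1] N t ⟨
    suc N C suc t
      ∎

  [p^k*Q]C[t*p^k]≡QCt-mod : ∀ k Q t → (p ^ k * Q) C (t * p ^ k) ≡ Q C t mod p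
  [p^k*Q]C[t*p^k]≡QCt-mod zero    Q t = begin
    (1 * Q) C (t * 1)                   ≡⟨ cong₂ _C_ (*-identityˡ Q) (*-identityʳ t) ⟩
    Q C t                               ∎
  [p^k*Q]C[t*p^k]≡QCt-mod (suc k) Q t = begin
    (p ^ suc k * Q) C (t * p ^ suc k)   ≡⟨ cong₂ _C_ (m^[1+n]*o≡m^n*o*m p k Q) t*p^[k+1]≡t*p^k*p ⟩
    (p ^ k * Q * p) C (t * p ^ k * p)   ≈⟨ [N*p]C[t*p]≡NCt-mod (p ^ k * Q) (t * p ^ k) ⟩
    (p ^ k * Q) C (t * p ^ k)           ≈⟨ [p^k*Q]C[t*p^k]≡QCt-mod k Q t ⟩
    Q C t                               ∎
    where
    t*p^[k+1]≡t*p^k*p : t * p ^ suc k ≡ t * p ^ k * p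
    t*p^[k+1]≡t*p^k*p = trans (cong (t *_) (*-comm p (p ^ k))) (sym (*-assoc t (p ^ k) p))

  ¬p^k∣a⇒p∣[p^k*Q]Ca : ∀ k Q a → ¬ p ^ k ∣ a → p ∣ (p ^ k * Q) C a
  ¬p^k∣a⇒p∣[p^k*Q]Ca zero    Q a 1∤a = ⊥-elim (1∤a (1∣ a))
  ¬p^k∣a⇒p∣[p^k*Q]Ca (suc k) Q a p^[k+1]∤a with p ∣? a
  ... | no p∤a = p∣n⇒¬p∣k⇒p∣nCk p-prime (p ^ suc k * Q) a (∣m⇒∣m*n Q (m∣m*n (p ^ k))) p∤a
  ... | yes (divides c refl) = ≡0-mod⇒∣ (begin
    (p ^ suc k * Q) C (c * p)   ≡⟨ cong (_C (c * p)) (m^[1+n]*o≡m^n*o*m p k Q) ⟩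
    (p ^ k * Q * p) C (c * p)   ≈⟨ [N*p]C[t*p]≡NCt-mod (p ^ k * Q) c ⟩
    (p ^ k * Q) C c             ≈⟨ ∣⇒≡0-mod (¬p^k∣a⇒p∣[p^k*Q]Ca k Q c p^k∤c) ⟩
    0                           ∎)
    where
    p^k∤c : ¬ p ^ k ∣ c
    p^k∤c p^k∣c = p^[k+1]∤a (subst (_∣ c * p) (*-comm (p ^ k) p) (*-monoˡ-∣ p p^k∣c))

  [p^k*Q]Ca≡lucas-mod : ∀ k Q a → (p ^ k * Q) C a ≡ lucas (p ^ k) Q a mod p
  [p^k*Q]Ca≡lucas-mod k Q a with p ^ k ∣? a
  ... | yes (divides t refl) = [p^k*Q]C[t*p^k]≡QCt-mod k Q t
  ... | no p^k∤a             = ∣⇒≡0-mod (¬p^k∣a⇒p∣[p^k*Q]Ca k Q a p^k∤a)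

  binomSum≡sum-lucas-mod : ∀ k Q xs → binomSum (p ^ k * Q) xs ≡ sum (map (lucas (p ^ k) Q) xs) mod p
  binomSum≡sum-lucas-mod k Q = sum-map-cong-mod ([p^k*Q]Ca≡lucas-mod k Q)

  p∣lucas[B,p^m] : ∀ B m a .{{_ : NonZero B}} → 0 < a → a < B * p ^ m → p ∣ lucas B (p ^ m) a
  p∣lucas[B,p^m] B m a 0<a a<B*p^m with B ∣? a
  ... | no _ = p ∣0
  ... | yes (divides t@(suc _) refl) =
    subst (λ Q → p ∣ Q C t) (*-identityʳ (p ^ m)) (¬p^k∣a⇒p∣[p^k*Q]Ca m 1 t p^m∤t)
    where
    t<p^m : t < p ^ m
    t<p^m = *-cancelʳ-< B t (p ^ m) (subst (t * B <_) (*-comm B (p ^ m)) a<B*p^m)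
    p^m∤t : ¬ p ^ m ∣ t
    p^m∤t p^m∣t = <⇒≱ t<p^m (∣⇒≤ p^m∣t)

  p∣sum-lucas[B,p^m] : ∀ B m .{{_ : NonZero B}} {xs} → All (0 <_) xs → All (_< B * p ^ m) xs →
    p ∣ sum (map (lucas B (p ^ m)) xs)
  p∣sum-lucas[B,p^m] B m 0<xs xs<B*p^m =
    ∣-sum-map (All.zipWith (λ (0<x , x<B*p^m) → p∣lucas[B,p^m] B m _ 0<x x<B*p^m) (0<xs , xs<B*p^m))

sumRange : (ℕ → ℕ) → ℕ → ℕ → ℕ
sumRange f lo zero      = 0
sumRange f lo (suc len) = f lo + sumRange f (suc lo) len

sumRange-+ : ∀ f lo x y → sumRange f lo (x + y) ≡ sumRange f lo x + sumRange f (lo + x) y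
sumRange-+ f lo zero    y rewrite +-identityʳ lo = refl
sumRange-+ f lo (suc x) y rewrite sumRange-+ f (suc lo) x y | +-suc lo x = sym (+-assoc (f lo) _ _)

sumRange-snoc : ∀ f lo len → sumRange f lo (suc len) ≡ sumRange f lo len + f (lo + len)
sumRange-snoc f lo len = begin
  sumRange f lo (suc len)                   ≡⟨ cong (sumRange f lo) (+-comm 1 len) ⟩
  sumRange f lo (len + 1)                   ≡⟨ sumRange-+ f lo len 1 ⟩
  sumRange f lo len + (f (lo + len) + 0)    ≡⟨ cong (sumRange f lo len +_) (+-identityʳ _) ⟩
  sumRange f lo len + f (lo + len)          ∎
  where open ≡-Reasoning

sumRange-vanishing : ∀ f lo len → (∀ i → lo ≤ i → i < lo + len → f i ≡ 0) → sumRange f lo len ≡ 0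
sumRange-vanishing f lo zero      _   = refl
sumRange-vanishing f lo (suc len) f≡0 rewrite f≡0 lo ≤-refl (m<m+n lo (s≤s z≤n)) =
  sumRange-vanishing f (suc lo) len λ i lo<i i<lo+1+len →
    f≡0 i (<⇒≤ lo<i) (subst (i <_) (sym (+-suc lo len)) i<lo+1+len)

sumRange-pascal : ∀ N lo len →
  sumRange (suc N C_) (suc lo) len ≡ sumRange (N C_) lo len + sumRange (N C_) (suc lo) len
sumRange-pascal N lo zero      = refl
sumRange-pascal N lo (suc len) = begin
  suc N C suc lo + sumRange (suc N C_) (suc (suc lo)) len
    ≡⟨ cong₂ _+_ ([n+1]C[k+1]≡nCk+nC[k+1] N lo) (sumRange-pascal N (suc lo) len) ⟩
  N C lo + N C suc lo + (S (suc lo) len + S (suc (suc lo)) len)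
    ≡⟨ interchange (N C lo) (N C suc lo) (S (suc lo) len) (S (suc (suc lo)) len) ⟩
  N C lo + S (suc lo) len + (N C suc lo + S (suc (suc lo)) len)
    ∎
  where
  open ≡-Reasoning
  S = sumRange (N C_)
  interchange : ∀ a b c e → a + b + (c + e) ≡ a + c + (b + e)
  interchange = solve-∀

sumRange-row : ∀ N → sumRange (N C_) 0 (suc N) ≡ 2 ^ N
sumRange-row zero    = refl
sumRange-row (suc N) = begin
  1 + sumRange (suc N C_) 1 (suc N)        ≡⟨ cong (1 +_) (sumRange-pascal N 0 (suc N)) ⟩
  1 + (row + sumRange (N C_) 1 (suc N))    ≡⟨ shuffle row (sumRange (N C_) 1 (suc N)) ⟩
  row + sumRange (N C_) 0 (suc (suc N))    ≡⟨ cong (row +_) (sumRange-snoc (N C_) 0 (suc N)) ⟩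
  row + (row + N C suc N)                  ≡⟨ cong (λ x → row + (row + x)) (k>n⇒nCk≡0 (n<1+n N)) ⟩
  row + (row + 0)                          ≡⟨ cong (λ x → x + (x + 0)) (sumRange-row N) ⟩
  2 ^ N + (2 ^ N + 0)                      ∎
  where
  open ≡-Reasoning
  row = sumRange (N C_) 0 (suc N)
  shuffle : ∀ a b → 1 + (a + b) ≡ a + (1 + b)
  shuffle = solve-∀

sumRange-lucas-block : ∀ B Q t .{{_ : NonZero B}} → sumRange (lucas B Q) (t * B) B ≡ Q C t
sumRange-lucas-block B@(suc B-1) Q t = begin
  lucas B Q (t * B) + sumRange (lucas B Q) (suc (t * B)) B-1   ≡⟨ cong₂ _+_ (lucas-multiple B Q t) interior ⟩
  Q C t + 0                                                    ≡⟨ +-identityʳ (Q C t) ⟩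
  Q C t                                                        ∎
  where
  open ≡-Reasoning
  end-of-block : suc (t * B) + B-1 ≡ suc t * B
  end-of-block = trans (sym (+-suc (t * B) B-1)) (+-comm (t * B) B)
  interior : sumRange (lucas B Q) (suc (t * B)) B-1 ≡ 0
  interior = sumRange-vanishing (lucas B Q) (suc (t * B)) B-1
    λ i t*B<i i<[t+1]*B → lucas-nonmultiple B Q i λ where
      (divides c refl) → <⇒≱ (*-cancelʳ-< B c (suc t) (subst (c * B <_) end-of-block i<[t+1]*B))
                             (*-cancelʳ-< B t c t*B<i)

sumRange-lucas : ∀ B Q M .{{_ : NonZero B}} → sumRange (lucas B Q) 0 (M * B) ≡ sumRange (Q C_) 0 M
sumRange-lucas B Q zero    = refl
sumRange-lucas B Q (suc M) = begin
  sumRange (lucas B Q) 0 (B + M * B)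
    ≡⟨ cong (sumRange (lucas B Q) 0) (+-comm B (M * B)) ⟩
  sumRange (lucas B Q) 0 (M * B + B)
    ≡⟨ sumRange-+ (lucas B Q) 0 (M * B) B ⟩
  sumRange (lucas B Q) 0 (M * B) + sumRange (lucas B Q) (M * B) B
    ≡⟨ cong₂ _+_ (sumRange-lucas B Q M) (sumRange-lucas-block B Q M) ⟩
  sumRange (Q C_) 0 M + Q C M
    ≡⟨ sumRange-snoc (Q C_) 0 M ⟨
  sumRange (Q C_) 0 (suc M)
    ∎
  where open ≡-Reasoning

sum-sorted≤sumRange : ∀ f lo len {xs} → Linked _<_ (lo ∷ xs) → All (_< suc lo + len) xs →
  sum (map f xs) ≤ sumRange f (suc lo) len
sum-sorted≤sumRange f lo len       {[]}     _              _            = z≤n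
sum-sorted≤sumRange f lo zero      {x ∷ xs} (lo<x ∷ _)     (x<1+lo ∷ _) =
  ⊥-elim (<⇒≱ x<1+lo (subst (_≤ x) (cong suc (sym (+-identityʳ lo))) lo<x))
sum-sorted≤sumRange f lo (suc len) {x ∷ xs} (lo<x ∷ x∷xs↑) x∷xs<end
  with m≤n⇒m<n∨m≡n lo<x | All.map (λ y< → ≤-trans y< (≤-reflexive (cong suc (+-suc lo len)))) x∷xs<end
... | inj₂ refl   | x∷xs<end′ =
  +-monoʳ-≤ (f (suc lo)) (sum-sorted≤sumRange f (suc lo) len x∷xs↑ (All.tail x∷xs<end′))
... | inj₁ 1+lo<x | x∷xs<end′ =
  ≤-trans (sum-sorted≤sumRange f (suc lo) len (1+lo<x ∷ x∷xs↑) x∷xs<end′) (m≤n+m _ (f (suc lo)))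

All⇒Linked-∷ : ∀ {x xs} → All (x <_) xs → Linked _<_ xs → Linked _<_ (x ∷ xs)
All⇒Linked-∷ []        _     = [-]
All⇒Linked-∷ (x<y ∷ _) y∷ys↑ = x<y ∷ y∷ys↑

2+sum-lucas-sorted≤2^Q : ∀ B Q .{{_ : NonZero B}} .{{_ : NonZero Q}} {xs} →
  Linked _<_ xs → All (0 <_) xs → All (_< B * Q) xs → 2 + sum (map (lucas B Q) xs) ≤ 2 ^ Q
2+sum-lucas-sorted≤2^Q B Q {xs} xs↑ 0<xs xs<B*Q = begin
  2 + sum (map f xs)             ≤⟨ +-monoʳ-≤ 2 (sum-sorted≤sumRange f 0 n-1 (All⇒Linked-∷ 0<xs xs↑) xs<1+n-1) ⟩
  2 + sumRange f 1 n-1           ≡⟨ cong (λ x → 1 + (x + sumRange f 1 n-1)) (lucas-multiple B Q 0) ⟨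
  1 + sumRange f 0 (suc n-1)     ≡⟨ cong (λ n → 1 + sumRange f 0 n) (trans (sym B*Q≡1+n-1) (*-comm B Q)) ⟩
  1 + sumRange f 0 (Q * B)       ≡⟨ cong (1 +_) (sumRange-lucas B Q Q) ⟩
  1 + sumRange (Q C_) 0 Q        ≡⟨ +-comm 1 _ ⟩
  sumRange (Q C_) 0 Q + 1        ≡⟨ cong (sumRange (Q C_) 0 Q +_) (nCn≡1 Q) ⟨
  sumRange (Q C_) 0 Q + Q C Q    ≡⟨ sumRange-snoc (Q C_) 0 Q ⟨
  sumRange (Q C_) 0 (suc Q)      ≡⟨ sumRange-row Q ⟩
  2 ^ Q                          ∎
  where
  open ≤-Reasoning
  f = lucas B Q
  n-1 = pred (B * Q)
  B*Q≡1+n-1 : B * Q ≡ suc n-1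
  B*Q≡1+n-1 = sym (suc-pred (B * Q) {{m*n≢0 B Q}})
  xs<1+n-1 : All (_< suc n-1) xs
  xs<1+n-1 = All.map (λ x< → ≤-trans x< (≤-reflexive B*Q≡1+n-1)) xs<B*Q

proposition4p2 : (p q k m : ℕ) → Prime p → Prime q → p ≢ q → 1 ≤ k →
    2 ^ (q ^ m) ≤ p →
    ¬ ∃₂ λ (as bs : List ℕ) →
        Linked _<_ as × All (2 <_) as × All (_< p ^ k * q ^ m) as ×
        Linked _<_ bs × All (1 <_) bs × All (_< p ^ k * q ^ m) bs ×
        (∀ a b → a ∈ as → b ∈ bs → a ≢ b) ×
        ((p ^ k * q ^ m) C 0 + binomSum (p ^ k * q ^ m) as
          ≡ (p ^ k * q ^ m) C 1 + binomSum (p ^ k * q ^ m) bs)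
proposition4p2 p q (suc k) m p-prime q-prime _ _ 2^Q≤p
  (as , bs , as↑ , 2<as , as<n , bs↑ , 1<bs , bs<n , _ , binomSum-as≡binomSum-bs) =
  ¬prime[1] (subst Prime (∣1⇒≡1 q∣1) q-prime)
  where
  instance
    p≢0   = prime⇒nonZero p-prime
    q≢0   = prime⇒nonZero q-prime
    p^k≢0 = m^n≢0 p (suc k)
    q^m≢0 = m^n≢0 q m
  n  = p ^ suc k * q ^ m
  Σf : List ℕ → ℕ
  Σf xs = sum (map (lucas (p ^ suc k) (q ^ m)) xs)
  0<as = All.map (≤-trans (s≤s z≤n)) 2<as
  0<bs = All.map (≤-trans (s≤s z≤n)) 1<bs

  congruent : 1 + Σf as ≡ Σf bs mod p
  congruent = begin
    1 + Σf as              ≈⟨ +-cong-mod (mk≡mod {1} refl) (binomSum≡sum-lucas-mod p-prime (suc k) (q ^ m) as) ⟨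
    1 + binomSum n as      ≡⟨ binomSum-as≡binomSum-bs ⟩
    n C 1 + binomSum n bs  ≈⟨ mk≡mod (%-remove-+ˡ (binomSum n bs) p∣nC1) ⟩
    binomSum n bs          ≈⟨ binomSum≡sum-lucas-mod p-prime (suc k) (q ^ m) bs ⟩
    Σf bs                  ∎
    where
    open SetoidReasoning (≡-mod-setoid {p})
    p∣nC1 : p ∣ n C 1
    p∣nC1 = subst (p ∣_) (sym (nC1≡n n)) (∣m⇒∣m*n (q ^ m) (m∣m*n (p ^ k)))

  2+Σf≤p : ∀ {xs} → Linked _<_ xs → All (0 <_) xs → All (_< n) xs → 2 + Σf xs ≤ p
  2+Σf≤p xs↑ 0<xs xs<n = ≤-trans (2+sum-lucas-sorted≤2^Q (p ^ suc k) (q ^ m) xs↑ 0<xs xs<n) 2^Q≤p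

  equal : 1 + Σf as ≡ Σf bs
  equal = ≡-mod⇒≡ (2+Σf≤p as↑ 0<as as<n) (≤-trans (n≤1+n _) (2+Σf≤p bs↑ 0<bs bs<n)) congruent

  q∣Σf : ∀ {xs} → All (0 <_) xs → All (_< n) xs → q ∣ Σf xs
  q∣Σf = p∣sum-lucas[B,p^m] q-prime (p ^ suc k) m

  q∣1 : q ∣ 1
  q∣1 = ∣m+n∣m⇒∣n (subst (q ∣_) (trans (sym equal) (+-comm 1 (Σf as))) (q∣Σf 0<bs bs<n)) (q∣Σf 0<as as<n)
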